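{- Let $R$ be a commutative ring with identity and let $I$ be a non-zero ideal of $R$. Then: (a) $\mathrm{girth}(\Gamma(R\Join I))=3$ if and only if $R$ is not an integral domain; (b) $\mathrm{girth}(\Gamma(R\Join I))=4$ if and only if $R$ is an integral domain and $|I|\ge 3$; (c) $\mathrm{girth}(\Gamma(R\Join I))=\infty$ if and only if $I=R\cong\mathbb Z_2$.
   Context: $R\Join I=\{(r,r+i)\mid r\in R,\ i\in I\}$ is the subring of $R\times R$ (componentwise operations), called the amalgamated duplication of $R$ along $I$. For a commutative ring $A$, $\Gamma(A)$ is the zero-divisor graph: its vertices are the non-zero zero-divisors of $A$, and distinct vertices $x,y$ are adjacent iff $xy=0$. The girth of a graph is the length of a shortest cycle, and is $\infty$ if there is no cycle. -}

module Defs where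

open import Level using (Level; _⊔_)
open import Data.Nat using (ℕ; zero; suc; _≤_; _<_)
open import Data.Fin using (Fin; inject₁; fromℕ)
open Fin
open import Data.Product using (Σ; ∃; _×_; _,_; proj₁; proj₂)
open import Data.Bool using (Bool; true; false; _xor_; _∧_)
open import Relation.Nullary using (¬_)
open import Relation.Unary using (Pred; _∈_)
open import Relation.Binary using (Rel)
open import Relation.Binary.PropositionalEquality using (_≡_)
open import Algebra.Bundles using (CommutativeRing)

module Graph {v e r : Level} (V : Set v) (_≃_ : Rel V e) (Adj : Rel V r) where

  record Cycle (m : ℕ) : Set (v ⊔ e ⊔ r) where
    field
      vert     : Fin (suc m) → V
      distinct : ∀ i j → vert i ≃ vert j → i ≡ j
      edge     : ∀ (i : Fin m) → Adj (vert (inject₁ i)) (vert (suc i))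
      close    : Adj (vert (fromℕ m)) (vert zero)

  -- The graph has a cycle of length n (a cycle has length ≥ 3).
  HasCycle : ℕ → Set (v ⊔ e ⊔ r)
  HasCycle n = Σ ℕ λ m → (n ≡ suc m) × (2 ≤ m) × Cycle m

  GirthIs : ℕ → Set (v ⊔ e ⊔ r)
  GirthIs n = HasCycle n × (∀ k → k < n → ¬ HasCycle k)

  GirthInfinite : Set (v ⊔ e ⊔ r)
  GirthInfinite = ∀ n → ¬ HasCycle n

-- Zero-divisor graph of a (sub)ring S ⊆ A, where A carries an equality,
-- a multiplication and a zero.  Zero-divisors are taken inside S.

module ZeroDivisorGraph {a ℓ p : Level} {A : Set a} (_≈_ : Rel A ℓ)
         (_*_ : A → A → A) (0# : A) (S : Pred A p) where

  IsVertex : Pred A (a ⊔ ℓ ⊔ p)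
  IsVertex x = S x × ¬ (x ≈ 0#) × (Σ A λ y → S y × ¬ (y ≈ 0#) × ((x * y) ≈ 0#))

  Vertex : Set (a ⊔ ℓ ⊔ p)
  Vertex = Σ A IsVertex

  _≃_ : Rel Vertex ℓ
  u ≃ w = proj₁ u ≈ proj₁ w

  Adj : Rel Vertex ℓ
  Adj u w = ¬ (u ≃ w) × ((proj₁ u * proj₁ w) ≈ 0#)

  open Graph Vertex _≃_ Adj public

module _ {c ℓ : Level} (R : CommutativeRing c ℓ) where
  open CommutativeRing R

  record IsIdeal {ℓi : Level} (I : Pred Carrier ℓi) : Set (c ⊔ ℓ ⊔ ℓi) where
    field
      resp  : ∀ {x y} → x ≈ y → x ∈ I → y ∈ I
      zero∈ : 0# ∈ I
      +∈    : ∀ {x y} → x ∈ I → y ∈ I → (x + y) ∈ I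
      -∈    : ∀ {x} → x ∈ I → (- x) ∈ I
      *∈    : ∀ r {x} → x ∈ I → (r * x) ∈ I

  NonZeroIdeal : {ℓi : Level} → Pred Carrier ℓi → Set (c ⊔ ℓ ⊔ ℓi)
  NonZeroIdeal I = IsIdeal I × (Σ Carrier λ x → x ∈ I × ¬ (x ≈ 0#))

  IsIntegralDomain : Set (c ⊔ ℓ)
  IsIntegralDomain = ¬ (1# ≈ 0#) × (∀ x y → (x * y) ≈ 0# → (x ≈ 0#) Data.Sum.⊎ (y ≈ 0#))
    where import Data.Sum

  AtLeast3 : {ℓi : Level} → Pred Carrier ℓi → Set (c ⊔ ℓ ⊔ ℓi)
  AtLeast3 I = Σ Carrier λ x → Σ Carrier λ y → Σ Carrier λ z →
    x ∈ I × y ∈ I × z ∈ I × ¬ (x ≈ y) × ¬ (x ≈ z) × ¬ (y ≈ z)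

  IsWhole : {ℓi : Level} → Pred Carrier ℓi → Set (c ⊔ ℓi)
  IsWhole I = ∀ x → x ∈ I

  record IsoZ2 : Set (c ⊔ ℓ) where
    field
      φ      : Carrier → Bool
      φ-cong : ∀ {x y} → x ≈ y → φ x ≡ φ y
      φ-inj  : ∀ {x y} → φ x ≡ φ y → x ≈ y
      φ-surj : ∀ b → Σ Carrier λ x → φ x ≡ b
      φ-+    : ∀ x y → φ (x + y) ≡ (φ x xor φ y)
      φ-*    : ∀ x y → φ (x * y) ≡ (φ x ∧ φ y)
      φ-1    : φ 1# ≡ true

  -- The amalgamated duplication R ⋈ I = {(r, r+i) | r ∈ R, i ∈ I} as a
  -- subset of R × R (componentwise operations).
  _×R_ : Set c
  _×R_ = Carrier × Carrier

  _≈²_ : Rel _×R_ ℓ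
  (a , b) ≈² (a' , b') = (a ≈ a') × (b ≈ b')

  _*²_ : _×R_ → _×R_ → _×R_
  (a , b) *² (a' , b') = (a * a') , (b * b')

  0² : _×R_
  0² = 0# , 0#

  Dup : {ℓi : Level} → Pred Carrier ℓi → Pred _×R_ (c ⊔ ℓ ⊔ ℓi)
  Dup I (r , s) = Σ Carrier λ i → i ∈ I × (s ≈ (r + i))

  module Γ⋈ {ℓi : Level} (I : Pred Carrier ℓi) =
    ZeroDivisorGraph _≈²_ _*²_ 0² (Dup I)

{-# OPTIONS --safe #-}
module Submission where

-- If ab = 0 with a, b ≠ 0 in R and i₀ ∈ I is non-zero, then either a kills i₀ or b kills the
-- non-zero element a·i₀ of I; so some c ∈ R∖{0} kills some k ∈ I∖{0}, and (c , c), (0 , k), (k , 0)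
-- is a triangle of Γ(R ⋈ I).  Two distinct non-zero i, j ∈ I give the square (i , 0), (0 , i),
-- (j , 0), (0 , j).  Conversely, if R is a domain, every vertex lies on one of the two axes and
-- adjacent vertices lie on different axes, so the graph is bipartite: it has no triangle, and
-- opposite corners of a square lie on a common axis, which yields two distinct non-zero elements
-- of I.  If there is no cycle at all, I∖{0} = {i₀}, so r·i₀ ∈ {0, i₀} forces r ∈ {0, 1} for every
-- r ∈ R; and if R = {0, 1}, each axis carries a single vertex, so there is no cycle.

open import Defs
open import Level using (Level; _⊔_)
open import Axiom.ExcludedMiddle using (ExcludedMiddle)
open import Algebra.Bundles using (CommutativeRing)
open import Relation.Unary using (Pred)
open import Relation.Nullary using (¬_)
open import Data.Product using (_×_)
open import Function.Bundles using (_⇔_)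

open import Function.Base using (_∘_; const; case_of_)
open import Function.Bundles using (mk⇔)
open import Data.Product using (Σ; _,_; proj₁; proj₂; uncurry)
open import Data.Sum using (_⊎_; inj₁; inj₂; [_,_]′)
open import Data.Nat using (suc; _≤_; z≤n; s≤s)
open import Data.Nat.Properties using (≤-refl; ≤-pred; ≤-antisym; <⇒≱)
open import Data.Fin using (Fin; zero; suc; inject₁)
open import Data.Bool using (Bool; true; false; _xor_; _∧_)
open import Data.Bool.Properties using (¬-not; xor-same)
open import Relation.Nullary using (yes; no; contradiction)
open import Relation.Nullary.Decidable using (isNo; decidable-stable)
open import Relation.Binary using (Rel; Symmetric)
open import Relation.Binary.PropositionalEquality
  using (_≡_; _≢_; refl; cong; subst; ≢-sym)
  renaming (sym to ≡-sym; trans to ≡-trans)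
import Algebra.Properties.Ring as RingProperties

module GraphProperties {v e r : Level} {V : Set v} {_≃_ : Rel V e} {Adj : Rel V r}
  (≃-sym : Symmetric _≃_) (adj⇒≄ : ∀ {u w} → Adj u w → ¬ u ≃ w) where

  open Graph V _≃_ Adj

  cycle-length≥3 : ∀ {n} → HasCycle n → 3 ≤ n
  cycle-length≥3 (_ , refl , 2≤m , _) = s≤s 2≤m

  girth≡3 : HasCycle 3 → GirthIs 3
  girth≡3 triangle = triangle , λ k k<3 → <⇒≱ k<3 ∘ cycle-length≥3

  girth≡4 : HasCycle 4 → ¬ HasCycle 3 → GirthIs 4
  girth≡4 square triangle-free = square , λ k k<4 cycle →
    triangle-free (subst HasCycle (≤-antisym (≤-pred k<4) (cycle-length≥3 cycle)) cycle)

  triangle : ∀ u v w → Adj u v → Adj v w → Adj w u → HasCycle 3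
  triangle u v w uv vw wu = 2 , refl , ≤-refl , record
    { vert = vert ; distinct = distinct ; edge = edge ; close = wu }
    where
    vert : Fin 3 → V
    vert zero = u
    vert (suc zero) = v
    vert (suc (suc zero)) = w
    distinct : ∀ i j → vert i ≃ vert j → i ≡ j
    distinct zero zero _ = refl
    distinct zero (suc zero) e = contradiction e (adj⇒≄ uv)
    distinct zero (suc (suc zero)) e = contradiction (≃-sym e) (adj⇒≄ wu)
    distinct (suc zero) zero e = contradiction (≃-sym e) (adj⇒≄ uv)
    distinct (suc zero) (suc zero) _ = refl
    distinct (suc zero) (suc (suc zero)) e = contradiction e (adj⇒≄ vw)
    distinct (suc (suc zero)) zero e = contradiction e (adj⇒≄ wu)
    distinct (suc (suc zero)) (suc zero) e = contradiction (≃-sym e) (adj⇒≄ vw)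
    distinct (suc (suc zero)) (suc (suc zero)) _ = refl
    edge : (i : Fin 2) → Adj (vert (inject₁ i)) (vert (suc i))
    edge zero = uv
    edge (suc zero) = vw

  square : ∀ u v w x → Adj u v → Adj v w → Adj w x → Adj x u → ¬ u ≃ w → ¬ v ≃ x → HasCycle 4
  square u v w x uv vw wx xu u≄w v≄x = 3 , refl , s≤s (s≤s z≤n) , record
    { vert = vert ; distinct = distinct ; edge = edge ; close = xu }
    where
    vert : Fin 4 → V
    vert zero = u
    vert (suc zero) = v
    vert (suc (suc zero)) = w
    vert (suc (suc (suc zero))) = x
    distinct : ∀ i j → vert i ≃ vert j → i ≡ j
    distinct zero zero _ = refl
    distinct zero (suc zero) e = contradiction e (adj⇒≄ uv)
    distinct zero (suc (suc zero)) e = contradiction e u≄w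
    distinct zero (suc (suc (suc zero))) e = contradiction (≃-sym e) (adj⇒≄ xu)
    distinct (suc zero) zero e = contradiction (≃-sym e) (adj⇒≄ uv)
    distinct (suc zero) (suc zero) _ = refl
    distinct (suc zero) (suc (suc zero)) e = contradiction e (adj⇒≄ vw)
    distinct (suc zero) (suc (suc (suc zero))) e = contradiction e v≄x
    distinct (suc (suc zero)) zero e = contradiction (≃-sym e) u≄w
    distinct (suc (suc zero)) (suc zero) e = contradiction (≃-sym e) (adj⇒≄ vw)
    distinct (suc (suc zero)) (suc (suc zero)) _ = refl
    distinct (suc (suc zero)) (suc (suc (suc zero))) e = contradiction e (adj⇒≄ wx)
    distinct (suc (suc (suc zero))) zero e = contradiction e (adj⇒≄ xu)
    distinct (suc (suc (suc zero))) (suc zero) e = contradiction (≃-sym e) v≄x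
    distinct (suc (suc (suc zero))) (suc (suc zero)) e = contradiction (≃-sym e) (adj⇒≄ wx)
    distinct (suc (suc (suc zero))) (suc (suc (suc zero))) _ = refl
    edge : (i : Fin 3) → Adj (vert (inject₁ i)) (vert (suc i))
    edge zero = uv
    edge (suc zero) = vw
    edge (suc (suc zero)) = wx

  ProperColouring : (V → Bool) → Set (v ⊔ r)
  ProperColouring colour = ∀ u w → Adj u w → colour u ≢ colour w

  proper⇒path-ends-same-colour : ∀ {colour} → ProperColouring colour →
                                 ∀ u v w → Adj u v → Adj v w → colour u ≡ colour w
  proper⇒path-ends-same-colour proper u v w uv vw =
    ≡-trans (¬-not (proper u v uv)) (≡-sym (¬-not (≢-sym (proper v w vw))))

  cycle-ends-same-colour : ∀ {colour m} → ProperColouring colour → (cycle : Cycle (suc (suc m))) →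
                           let open Cycle cycle in
                           colour (vert zero) ≡ colour (vert (suc (suc zero)))
  cycle-ends-same-colour proper cycle =
    proper⇒path-ends-same-colour proper _ _ _ (edge zero) (edge (suc zero))
    where open Cycle cycle

  proper⇒triangle-free : ∀ {colour} → ProperColouring colour → ¬ HasCycle 3
  proper⇒triangle-free proper (_ , refl , _ , cycle) =
    proper _ _ (close cycle) (≡-sym (cycle-ends-same-colour proper cycle))
    where open Cycle

  injective-colouring⇒acyclic : (colour : V → Bool) → (∀ {u w} → colour u ≡ colour w → u ≃ w) →
                                GirthInfinite
  injective-colouring⇒acyclic colour injective _ (suc (suc _) , _ , _ , cycle) =
    contradiction (distinct cycle zero (suc (suc zero)) (injective same-colour)) λ ()
    where
    open Cycle
    proper : ProperColouring colour
    proper _ _ uw = adj⇒≄ uw ∘ injective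
    same-colour = cycle-ends-same-colour proper cycle
  injective-colouring⇒acyclic _ _ _ (0 , _ , () , _)
  injective-colouring⇒acyclic _ _ _ (1 , _ , s≤s () , _)

module CommutativeRingProperties {c ℓ : Level} (R : CommutativeRing c ℓ) where

  open CommutativeRing R renaming (refl to ≈-refl)
  open RingProperties ring using (x∙y⁻¹≈ε⇒x≈y; [y-z]x≈yx-zx; x+x≈x⇒x≈0)
  open import Relation.Binary.Reasoning.Setoid setoid

  ZeroOrOne : Set (c ⊔ ℓ)
  ZeroOrOne = ∀ x → x ≈ 0# ⊎ x ≈ 1#

  x≉0⇒1≉0 : ∀ {x} → x ≉ 0# → 1# ≉ 0#
  x≉0⇒1≉0 {x} x≉0 1≈0 = x≉0 (begin
    x       ≈⟨ *-identityˡ x ⟨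
    1# * x  ≈⟨ *-congʳ 1≈0 ⟩
    0# * x  ≈⟨ zeroˡ x ⟩
    0#      ∎)

  ZeroDivisors : Set (c ⊔ ℓ)
  ZeroDivisors = Σ Carrier λ a → Σ Carrier λ b → a ≉ 0# × b ≉ 0# × a * b ≈ 0#

  ¬domain⇒zeroDivisors : (∀ {a} → ExcludedMiddle a) → 1# ≉ 0# → ¬ IsIntegralDomain R →
                         ZeroDivisors
  ¬domain⇒zeroDivisors em 1≉0 ¬domain = decidable-stable em λ none →
    ¬domain (1≉0 , λ x y xy≈0 → case-split none x y xy≈0)
    where
    case-split : ¬ ZeroDivisors → ∀ x y → x * y ≈ 0# → x ≈ 0# ⊎ y ≈ 0#
    case-split none x y xy≈0 with em {P = x ≈ 0#} | em {P = y ≈ 0#}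
    ... | yes x≈0 | _ = inj₁ x≈0
    ... | no _ | yes y≈0 = inj₂ y≈0
    ... | no x≉0 | no y≉0 = contradiction (x , y , x≉0 , y≉0 , xy≈0) none

  module Domain (domain : IsIntegralDomain R) where

    x≉0∧y≉0⇒x*y≉0 : ∀ {x y} → x ≉ 0# → y ≉ 0# → x * y ≉ 0#
    x≉0∧y≉0⇒x*y≉0 {x} {y} x≉0 y≉0 xy≈0 with proj₂ domain x y xy≈0
    ... | inj₁ x≈0 = x≉0 x≈0
    ... | inj₂ y≈0 = y≉0 y≈0

    *-cancelʳ : ∀ {i r s} → i ≉ 0# → r * i ≈ s * i → r ≈ s
    *-cancelʳ {i} {r} {s} i≉0 ri≈si with proj₂ domain (r - s) i (begin
      (r - s) * i    ≈⟨ [y-z]x≈yx-zx i r s ⟩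
      r * i - s * i  ≈⟨ +-congʳ ri≈si ⟩
      s * i - s * i  ≈⟨ -‿inverseʳ (s * i) ⟩
      0#             ∎)
    ... | inj₁ r-s≈0 = x∙y⁻¹≈ε⇒x≈y r s r-s≈0
    ... | inj₂ i≈0 = contradiction i≈0 i≉0

  zeroOrOne⇒domain : 1# ≉ 0# → ZeroOrOne → IsIntegralDomain R
  zeroOrOne⇒domain 1≉0 zeroOrOne = 1≉0 , λ x y xy≈0 → case zeroOrOne x of λ where
    (inj₁ x≈0) → inj₁ x≈0
    (inj₂ x≈1) → inj₂ (begin
      y       ≈⟨ *-identityˡ y ⟨
      1# * y  ≈⟨ *-congʳ x≈1 ⟨
      x * y   ≈⟨ xy≈0 ⟩
      0#      ∎)

  isoZ2⇒zeroOrOne : IsoZ2 R → 1# ≉ 0# × ZeroOrOne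
  isoZ2⇒zeroOrOne iso = 1≉0 , zeroOrOne
    where
    open IsoZ2 iso

    φ-0 : φ 0# ≡ false
    φ-0 = ≡-trans (φ-cong (sym (+-identityˡ 0#))) (≡-trans (φ-+ 0# 0#) (xor-same (φ 0#)))

    1≉0 : 1# ≉ 0#
    1≉0 1≈0 = contradiction (≡-trans (≡-sym φ-1) (≡-trans (φ-cong 1≈0) φ-0)) λ ()

    zeroOrOne : ZeroOrOne
    zeroOrOne x with φ x in φx
    ... | false = inj₁ (φ-inj (≡-trans φx (≡-sym φ-0)))
    ... | true = inj₂ (φ-inj (≡-trans φx (≡-sym φ-1)))

  zeroOrOne⇒isoZ2 : (∀ {a} → ExcludedMiddle a) → 1# ≉ 0# → ZeroOrOne → IsoZ2 R
  zeroOrOne⇒isoZ2 em 1≉0 zeroOrOne = record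
    { φ = φ ; φ-cong = φ-cong ; φ-inj = φ-inj ; φ-surj = λ b → ψ b , φ-ψ b
    ; φ-+ = φ-+ ; φ-* = φ-* ; φ-1 = φ-ψ true }
    where
    φ : Carrier → Bool
    φ x = isNo (em {P = x ≈ 0#})

    -- φ inherits additivity and multiplicativity from its inverse ψ, which has them case by case.
    ψ : Bool → Carrier
    ψ false = 0#
    ψ true = 1#

    φ-ψ : ∀ b → φ (ψ b) ≡ b
    φ-ψ false with em {P = 0# ≈ 0#}
    ... | yes _ = refl
    ... | no 0≉0 = contradiction ≈-refl 0≉0
    φ-ψ true with em {P = 1# ≈ 0#}
    ... | yes 1≈0 = contradiction 1≈0 1≉0
    ... | no _ = refl

    ψ-φ : ∀ x → x ≈ ψ (φ x)
    ψ-φ x with em {P = x ≈ 0#} | zeroOrOne x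
    ... | yes x≈0 | _ = x≈0
    ... | no x≉0 | inj₁ x≈0 = contradiction x≈0 x≉0
    ... | no _ | inj₂ x≈1 = x≈1

    φ-cong : ∀ {x y} → x ≈ y → φ x ≡ φ y
    φ-cong {x} {y} x≈y with em {P = x ≈ 0#} | em {P = y ≈ 0#}
    ... | yes _ | yes _ = refl
    ... | yes x≈0 | no y≉0 = contradiction (trans (sym x≈y) x≈0) y≉0
    ... | no x≉0 | yes y≈0 = contradiction (trans x≈y y≈0) x≉0
    ... | no _ | no _ = refl

    φ-inj : ∀ {x y} → φ x ≡ φ y → x ≈ y
    φ-inj {x} {y} φx≡φy = begin
      x        ≈⟨ ψ-φ x ⟩
      ψ (φ x)  ≡⟨ cong ψ φx≡φy ⟩
      ψ (φ y)  ≈⟨ ψ-φ y ⟨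
      y        ∎

    1+1≈0 : 1# + 1# ≈ 0#
    1+1≈0 with zeroOrOne (1# + 1#)
    ... | inj₁ 1+1≈0 = 1+1≈0
    ... | inj₂ 1+1≈1 = contradiction (x+x≈x⇒x≈0 1# 1+1≈1) 1≉0

    ψ-xor : ∀ a b → ψ a + ψ b ≈ ψ (a xor b)
    ψ-xor false b = +-identityˡ (ψ b)
    ψ-xor true false = +-identityʳ 1#
    ψ-xor true true = 1+1≈0

    ψ-∧ : ∀ a b → ψ a * ψ b ≈ ψ (a ∧ b)
    ψ-∧ false b = zeroˡ (ψ b)
    ψ-∧ true b = *-identityˡ (ψ b)

    φ-+ : ∀ x y → φ (x + y) ≡ (φ x xor φ y)
    φ-+ x y = ≡-trans (φ-cong (trans (+-cong (ψ-φ x) (ψ-φ y)) (ψ-xor (φ x) (φ y)))) (φ-ψ _)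

    φ-* : ∀ x y → φ (x * y) ≡ (φ x ∧ φ y)
    φ-* x y = ≡-trans (φ-cong (trans (*-cong (ψ-φ x) (ψ-φ y)) (ψ-∧ (φ x) (φ y)))) (φ-ψ _)

module AmalgamatedDuplication {c ℓ ℓi : Level} (R : CommutativeRing c ℓ)
  {I : Pred (CommutativeRing.Carrier R) ℓi} (I-ideal : IsIdeal R I) where

  open CommutativeRing R hiding (zero; refl)
  open CommutativeRingProperties R
  open RingProperties ring using (+-inverseˡ-unique)
  open IsIdeal I-ideal
  open Γ⋈ R I
  open GraphProperties {V = Vertex} {_≃_ = _≃_} {Adj = Adj}
    (λ (x≈x′ , y≈y′) → sym x≈x′ , sym y≈y′) proj₁
  open import Relation.Binary.Reasoning.Setoid setoid

  I⁺ : Set (c ⊔ ℓ ⊔ ℓi)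
  I⁺ = Σ Carrier λ k → I k × k ≉ 0#

  TwoDistinctNonZero : Set (c ⊔ ℓ ⊔ ℓi)
  TwoDistinctNonZero = Σ I⁺ λ i → Σ I⁺ λ j → proj₁ i ≉ proj₁ j

  twoDistinctNonZero⇒atLeast3 : TwoDistinctNonZero → AtLeast3 R I
  twoDistinctNonZero⇒atLeast3 ((i , i∈I , i≉0) , (j , j∈I , j≉0) , i≉j) =
    0# , i , j , zero∈ , i∈I , j∈I , i≉0 ∘ sym , j≉0 ∘ sym , i≉j

  atLeast3⇒twoDistinctNonZero : (∀ {a} → ExcludedMiddle a) → AtLeast3 R I → TwoDistinctNonZero
  atLeast3⇒twoDistinctNonZero em (x , y , z , x∈I , y∈I , z∈I , x≉y , x≉z , y≉z)
    with em {P = x ≈ 0#} | em {P = y ≈ 0#}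
  ... | yes x≈0 | _ = (y , y∈I , x≉y ∘ trans x≈0 ∘ sym) , (z , z∈I , x≉z ∘ trans x≈0 ∘ sym) , y≉z
  ... | no x≉0 | yes y≈0 = (x , x∈I , x≉0) , (z , z∈I , y≉z ∘ trans y≈0 ∘ sym) , x≉z
  ... | no x≉0 | no y≉0 = (x , x∈I , x≉0) , (y , y∈I , y≉0) , x≉y

  first≈0⇒second∈I : ∀ {x y} → Dup R I (x , y) → x ≈ 0# → I y
  first≈0⇒second∈I {x} {y} (i , i∈I , y≈x+i) x≈0 = resp (sym (begin
    y       ≈⟨ y≈x+i ⟩
    x + i   ≈⟨ +-congʳ x≈0 ⟩
    0# + i  ≈⟨ +-identityˡ i ⟩
    i       ∎)) i∈I

  second≈0⇒first∈I : ∀ {x y} → Dup R I (x , y) → y ≈ 0# → I x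
  second≈0⇒first∈I {x} (i , i∈I , y≈x+i) y≈0 =
    resp (sym (+-inverseˡ-unique x i (trans (sym y≈x+i) y≈0))) (-∈ i∈I)

  onFirstAxis∈ : ∀ {k} → I k → Dup R I (k , 0#)
  onFirstAxis∈ {k} k∈I = - k , -∈ k∈I , sym (-‿inverseʳ k)

  onSecondAxis∈ : ∀ {k} → I k → Dup R I (0# , k)
  onSecondAxis∈ {k} k∈I = k , k∈I , sym (+-identityˡ k)

  firstAxisVertex : I⁺ → Vertex
  firstAxisVertex (k , k∈I , k≉0) =
    (k , 0#) , onFirstAxis∈ k∈I , k≉0 ∘ proj₁ ,
    (0# , k) , onSecondAxis∈ k∈I , k≉0 ∘ proj₂ , zeroʳ k , zeroˡ k

  secondAxisVertex : I⁺ → Vertex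
  secondAxisVertex (k , k∈I , k≉0) =
    (0# , k) , onSecondAxis∈ k∈I , k≉0 ∘ proj₂ ,
    (k , 0#) , onFirstAxis∈ k∈I , k≉0 ∘ proj₁ , zeroˡ k , zeroʳ k

  axes-adjacent : ∀ i j → Adj (firstAxisVertex i) (secondAxisVertex j)
  axes-adjacent (i , _ , i≉0) (j , _) = i≉0 ∘ proj₁ , zeroʳ i , zeroˡ j

  axes-adjacent′ : ∀ i j → Adj (secondAxisVertex j) (firstAxisVertex i)
  axes-adjacent′ (i , _) (j , _ , j≉0) = j≉0 ∘ proj₂ , zeroˡ i , zeroʳ j

  twoDistinctNonZero⇒square : TwoDistinctNonZero → HasCycle 4
  twoDistinctNonZero⇒square (i , j , i≉j) =
    square (firstAxisVertex i) (secondAxisVertex i) (firstAxisVertex j) (secondAxisVertex j)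
           (axes-adjacent i i) (axes-adjacent′ j i) (axes-adjacent j j) (axes-adjacent′ i j)
           (i≉j ∘ proj₁) (i≉j ∘ proj₂)

  annihilator⇒triangle : ∀ {a} → a ≉ 0# → (k : I⁺) → a * proj₁ k ≈ 0# → HasCycle 3
  annihilator⇒triangle {a} a≉0 k@(k′ , k∈I , k≉0) ak≈0 =
    triangle diagonal (secondAxisVertex k) (firstAxisVertex k)
      (a≉0 ∘ proj₁ , zeroʳ a , ak≈0)
      (axes-adjacent′ k k)
      (a≉0 ∘ sym ∘ proj₂ , trans (*-comm k′ a) ak≈0 , zeroˡ a)
    where
    diagonal : Vertex
    diagonal = (a , a) , (0# , zero∈ , sym (+-identityʳ a)) , a≉0 ∘ proj₁ ,
               (0# , k′) , onSecondAxis∈ k∈I , k≉0 ∘ proj₂ , zeroʳ a , ak≈0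

  module InDomain (domain : IsIntegralDomain R) where

    open Domain domain

    onAxis : ∀ {p} → IsVertex p → proj₂ p ≈ 0# ⊎ proj₁ p ≈ 0#
    onAxis {x , y} (_ , _ , (x′ , y′) , _ , partner≉0 , xx′≈0 , yy′≈0)
      with proj₂ domain x x′ xx′≈0 | proj₂ domain y y′ yy′≈0
    ... | inj₁ x≈0 | _ = inj₂ x≈0
    ... | inj₂ _ | inj₁ y≈0 = inj₁ y≈0
    ... | inj₂ x′≈0 | inj₂ y′≈0 = contradiction (x′≈0 , y′≈0) partner≉0

    axisColour : Vertex → Bool
    axisColour (_ , v) = [ const true , const false ]′ (onAxis v)

    OnSameAxis : Rel Vertex ℓ
    OnSameAxis ((x , y) , _) ((x′ , y′) , _) = (y ≈ 0# × y′ ≈ 0#) ⊎ (x ≈ 0# × x′ ≈ 0#)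

    sameColour⇒onSameAxis : ∀ u w → axisColour u ≡ axisColour w → OnSameAxis u w
    sameColour⇒onSameAxis (_ , u) (_ , w) same with onAxis u | onAxis w
    ... | inj₁ y≈0 | inj₁ y′≈0 = inj₁ (y≈0 , y′≈0)
    ... | inj₂ x≈0 | inj₂ x′≈0 = inj₂ (x≈0 , x′≈0)
    ... | inj₁ _ | inj₂ _ = contradiction same λ ()
    ... | inj₂ _ | inj₁ _ = contradiction same λ ()

    adjacent⇒¬onSameAxis : ∀ u w → Adj u w → ¬ OnSameAxis u w
    adjacent⇒¬onSameAxis (_ , _ , u≉0 , _) (_ , _ , w≉0 , _) (_ , xx′≈0 , _)
      (inj₁ (y≈0 , y′≈0)) = x≉0∧y≉0⇒x*y≉0 (u≉0 ∘ (_, y≈0)) (w≉0 ∘ (_, y′≈0)) xx′≈0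
    adjacent⇒¬onSameAxis (_ , _ , u≉0 , _) (_ , _ , w≉0 , _) (_ , _ , yy′≈0)
      (inj₂ (x≈0 , x′≈0)) = x≉0∧y≉0⇒x*y≉0 (u≉0 ∘ (x≈0 ,_)) (w≉0 ∘ (x′≈0 ,_)) yy′≈0

    axisColour-proper : ProperColouring axisColour
    axisColour-proper u w uw = adjacent⇒¬onSameAxis u w uw ∘ sameColour⇒onSameAxis u w

    triangle-free : ¬ HasCycle 3
    triangle-free = proper⇒triangle-free axisColour-proper

    distinct-onSameAxis⇒twoDistinctNonZero : ∀ u w → ¬ u ≃ w → OnSameAxis u w →
                                             TwoDistinctNonZero
    distinct-onSameAxis⇒twoDistinctNonZero ((x , _) , u∈ , u≉0 , _) ((x′ , _) , w∈ , w≉0 , _) u≄w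
      (inj₁ (y≈0 , y′≈0)) =
      (x , second≈0⇒first∈I u∈ y≈0 , u≉0 ∘ (_, y≈0)) ,
      (x′ , second≈0⇒first∈I w∈ y′≈0 , w≉0 ∘ (_, y′≈0)) ,
      u≄w ∘ (_, trans y≈0 (sym y′≈0))
    distinct-onSameAxis⇒twoDistinctNonZero ((_ , y) , u∈ , u≉0 , _) ((_ , y′) , w∈ , w≉0 , _) u≄w
      (inj₂ (x≈0 , x′≈0)) =
      (y , first≈0⇒second∈I u∈ x≈0 , u≉0 ∘ (x≈0 ,_)) ,
      (y′ , first≈0⇒second∈I w∈ x′≈0 , w≉0 ∘ (x′≈0 ,_)) ,
      u≄w ∘ (trans x≈0 (sym x′≈0) ,_)

    square⇒twoDistinctNonZero : HasCycle 4 → TwoDistinctNonZero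
    square⇒twoDistinctNonZero (_ , refl , _ , cycle) =
      distinct-onSameAxis⇒twoDistinctNonZero v₀ v₂
        (λ v₀≃v₂ → contradiction (distinct cycle zero (suc (suc zero)) v₀≃v₂) λ ())
        (sameColour⇒onSameAxis v₀ v₂ (cycle-ends-same-colour axisColour-proper cycle))
      where
      open Cycle
      v₀ = vert cycle zero
      v₂ = vert cycle (suc (suc zero))

  module InZ2 (1≉0 : 1# ≉ 0#) (zeroOrOne : ZeroOrOne) where

    open InDomain (zeroOrOne⇒domain 1≉0 zeroOrOne)

    x≉0⇒x≈1 : ∀ {x} → x ≉ 0# → x ≈ 1#
    x≉0⇒x≈1 {x} x≉0 with zeroOrOne x
    ... | inj₁ x≈0 = contradiction x≈0 x≉0
    ... | inj₂ x≈1 = x≈1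

    onSameAxis⇒≃ : ∀ u w → OnSameAxis u w → u ≃ w
    onSameAxis⇒≃ (_ , _ , u≉0 , _) (_ , _ , w≉0 , _) (inj₁ (y≈0 , y′≈0)) =
      trans (x≉0⇒x≈1 (u≉0 ∘ (_, y≈0))) (sym (x≉0⇒x≈1 (w≉0 ∘ (_, y′≈0)))) ,
      trans y≈0 (sym y′≈0)
    onSameAxis⇒≃ (_ , _ , u≉0 , _) (_ , _ , w≉0 , _) (inj₂ (x≈0 , x′≈0)) =
      trans x≈0 (sym x′≈0) ,
      trans (x≉0⇒x≈1 (u≉0 ∘ (x≈0 ,_))) (sym (x≉0⇒x≈1 (w≉0 ∘ (x′≈0 ,_))))

    acyclic : GirthInfinite
    acyclic = injective-colouring⇒acyclic axisColour λ {u} {w} →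
      onSameAxis⇒≃ u w ∘ sameColour⇒onSameAxis u w

  module Girth (em : ∀ {a} → ExcludedMiddle a) {i} (i∈I : I i) (i≉0 : i ≉ 0#) where

    i₀ : I⁺
    i₀ = i , i∈I , i≉0

    1≉0 : 1# ≉ 0#
    1≉0 = x≉0⇒1≉0 i≉0

    ¬domain⇒triangle : ¬ IsIntegralDomain R → HasCycle 3
    ¬domain⇒triangle ¬domain with ¬domain⇒zeroDivisors em 1≉0 ¬domain
    ... | a , b , a≉0 , b≉0 , ab≈0 with em {P = a * i ≈ 0#}
    ...   | yes ai≈0 = annihilator⇒triangle a≉0 i₀ ai≈0
    ...   | no ai≉0 = annihilator⇒triangle b≉0 (a * i , *∈ a i∈I , ai≉0) (begin
      b * (a * i)  ≈⟨ *-assoc b a i ⟨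
      (b * a) * i  ≈⟨ *-congʳ (*-comm b a) ⟩
      (a * b) * i  ≈⟨ *-congʳ ab≈0 ⟩
      0# * i       ≈⟨ zeroˡ i ⟩
      0#           ∎)

    triangle-free⇒domain : ¬ HasCycle 3 → IsIntegralDomain R
    triangle-free⇒domain triangle-free = decidable-stable em (triangle-free ∘ ¬domain⇒triangle)

    module _ (acyclic : GirthInfinite) where

      open Domain (triangle-free⇒domain (acyclic 3))

      acyclic⇒nonZero≈i : ∀ {x} → I x → x ≉ 0# → x ≈ i
      acyclic⇒nonZero≈i {x} x∈I x≉0 = decidable-stable em λ x≉i →
        acyclic 4 (twoDistinctNonZero⇒square ((x , x∈I , x≉0) , i₀ , x≉i))

      acyclic⇒zeroOrOne : ZeroOrOne
      acyclic⇒zeroOrOne r with em {P = r * i ≈ 0#}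
      ... | yes ri≈0 = inj₁ (*-cancelʳ i≉0 (trans ri≈0 (sym (zeroˡ i))))
      ... | no ri≉0 = inj₂ (*-cancelʳ i≉0 (begin
        r * i   ≈⟨ acyclic⇒nonZero≈i (*∈ r i∈I) ri≉0 ⟩
        i       ≈⟨ *-identityˡ i ⟨
        1# * i  ∎))

    zeroOrOne⇒whole : ZeroOrOne → IsWhole R I
    zeroOrOne⇒whole zeroOrOne x with zeroOrOne i
    ... | inj₁ i≈0 = contradiction i≈0 i≉0
    ... | inj₂ i≈1 = resp (trans (*-congˡ i≈1) (*-identityʳ x)) (*∈ x i∈I)

    girth≡3⇔¬domain : GirthIs 3 ⇔ (¬ IsIntegralDomain R)
    girth≡3⇔¬domain = mk⇔ (λ (triangle , _) domain → InDomain.triangle-free domain triangle)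
                           (girth≡3 ∘ ¬domain⇒triangle)

    girth≡4⇔domain×atLeast3 : GirthIs 4 ⇔ (IsIntegralDomain R × AtLeast3 R I)
    girth≡4⇔domain×atLeast3 = mk⇔
      (λ (square , no-shorter) → let domain = triangle-free⇒domain (no-shorter 3 ≤-refl) in
        domain , twoDistinctNonZero⇒atLeast3 (InDomain.square⇒twoDistinctNonZero domain square))
      (λ (domain , atLeast3) →
        girth≡4 (twoDistinctNonZero⇒square (atLeast3⇒twoDistinctNonZero em atLeast3))
                (InDomain.triangle-free domain))

    acyclic⇔whole×isoZ2 : GirthInfinite ⇔ (IsWhole R I × IsoZ2 R)
    acyclic⇔whole×isoZ2 = mk⇔
      (λ acyclic → let zeroOrOne = acyclic⇒zeroOrOne acyclic in
        zeroOrOne⇒whole zeroOrOne , zeroOrOne⇒isoZ2 em 1≉0 zeroOrOne)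
      (uncurry InZ2.acyclic ∘ isoZ2⇒zeroOrOne ∘ proj₂)

corollary3p3 : (em : ∀ {a} → ExcludedMiddle a)
    → ∀ {c ℓ ℓi} (R : CommutativeRing c ℓ)
    → (I : Pred (CommutativeRing.Carrier R) ℓi) → NonZeroIdeal R I
    → (Γ⋈.GirthIs R I 3 ⇔ (¬ IsIntegralDomain R))
      × (Γ⋈.GirthIs R I 4 ⇔ (IsIntegralDomain R × AtLeast3 R I))
      × (Γ⋈.GirthInfinite R I ⇔ (IsWhole R I × IsoZ2 R))
corollary3p3 em R I (I-ideal , _ , i∈I , i≉0) =
  girth≡3⇔¬domain , girth≡4⇔domain×atLeast3 , acyclic⇔whole×isoZ2
  where open AmalgamatedDuplication.Girth R I-ideal em i∈I i≉0
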